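{- Let $n,s,\ell,c$ be positive integers with $n=2s+c=3s-\ell$ and $c,\ell\in\{1,\dots,s-1\}$. Then none of the families $\mathcal{P}(s,\ell)$, $\mathcal{P}'(s,\ell)$, $\mathcal{Q}(s,\ell)$, $\mathcal{W}(s,\ell)$ contains $s$ pairwise disjoint members.
   Context: $[n]=\{1,\dots,n\}$, $[a,b]=\{a,\dots,b\}$ (empty if $b<a$), $\binom{X}{k}$ the $k$-element subsets of $X$, $\binom{X}{\ge k}$ the subsets of size at least $k$. Define $\mathcal{P}(s,\ell)=\{P\subset[n]: |P|+|P\cap[\ell-1]|\ge 3\}$; $\mathcal{P}'(s,\ell)=\binom{[n]}{\ge 3}\cup\binom{[2\ell-1]}{2}$; $\mathcal{Q}(s,\ell)=\Big(\binom{[n]}{\ge 3}\cup\binom{[s+\ell-1]}{2}\Big)\setminus\binom{[s+\ell,n]}{3}$; $\mathcal{W}(s,\ell)=\{P\subset[n]: |P\cap[2s-1]|\ge 2\}$. -}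

module Defs where

open import Data.Nat using (ℕ; _+_; _*_; _∸_; _≤_; _≥_; _≤ᵇ_)
open import Data.Bool using (_∧_)
open import Data.Fin using (Fin; toℕ)
open import Data.Fin.Subset using (Subset; _∈_; _⊆_; _∩_; ∣_∣)
open import Data.Vec using (tabulate)
open import Data.Product using (_×_)
open import Data.Sum using (_⊎_)
open import Relation.Nullary using (¬_)
open import Relation.Binary.PropositionalEquality using (_≡_; _≢_)

-- Ground set [n] = {1,…,n} is modelled by Fin n; the index i : Fin n
-- represents the element  toℕ i + 1.

interval : (n a b : ℕ) → Subset n
interval n a b = tabulate (λ i → (a ≤ᵇ (toℕ i + 1)) ∧ ((toℕ i + 1) ≤ᵇ b))

upto : (n m : ℕ) → Subset n
upto n m = interval n 1 m

Family : ℕ → Set₁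
Family n = Subset n → Set

𝒫 : (n s ℓ : ℕ) → Family n
𝒫 n s ℓ P = ∣ P ∣ + ∣ P ∩ upto n (ℓ ∸ 1) ∣ ≥ 3

𝒫′ : (n s ℓ : ℕ) → Family n
𝒫′ n s ℓ P = (∣ P ∣ ≥ 3) ⊎ (∣ P ∣ ≡ 2 × P ⊆ upto n (2 * ℓ ∸ 1))

𝒬 : (n s ℓ : ℕ) → Family n
𝒬 n s ℓ P =
  ((∣ P ∣ ≥ 3) ⊎ (∣ P ∣ ≡ 2 × P ⊆ upto n (s + ℓ ∸ 1)))
  × ¬ (∣ P ∣ ≡ 3 × P ⊆ interval n (s + ℓ) n)

𝒲 : (n s ℓ : ℕ) → Family n
𝒲 n s ℓ P = ∣ P ∩ upto n (2 * s ∸ 1) ∣ ≥ 2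

Disjoint : {n : ℕ} → Subset n → Subset n → Set
Disjoint {n} P Q = (x : Fin n) → ¬ (x ∈ P × x ∈ Q)

HasDisjointMembers : {n : ℕ} → Family n → ℕ → Set
HasDisjointMembers {n} ℱ k =
  Data.Product.Σ (Fin k → Subset n) λ F →
    ((i : Fin k) → ℱ (F i)) × ((i j : Fin k) → i ≢ j → Disjoint (F i) (F j))

-- Give P ⊆ [n] the weight a|P| + |P ∩ [m-1]|, with a, m chosen per family so that
-- every member weighs at least c while a·n + m = s·c.  Weight is additive over
-- disjoint sets, so s pairwise disjoint members would weigh at least s·c, but all of
-- [n] weighs only a·n + (m - 1) < s·c.  The choices (a, c, m) are (1, 3, ℓ) for 𝒫,
-- (2, 6, 2ℓ) for 𝒫′, (1, 4, s + ℓ) for 𝒬 and (0, 2, 2s) for 𝒲; each uses n + ℓ = 3s.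
-- A triple of 𝒬 reaches weight 4 because it may not lie in [s+ℓ, n], so it
-- meets [s+ℓ-1].

module Submission where

open import Defs
open import Data.Nat using (ℕ; _+_; _*_; _∸_; _≤_)
open import Data.Product using (_×_)
open import Relation.Nullary using (¬_)
open import Relation.Binary.PropositionalEquality using (_≡_)

open import Data.Nat using (zero; suc; _<_; z≤n; s≤s; z<s)
open import Data.Nat.Properties
open import Data.Nat.Solver using (module +-*-Solver)
open import Data.Bool.Properties using (T-≡; T-∧)
open import Data.Fin as Fin using (Fin; toℕ)
open import Data.Fin.Properties as Finₚ using (toℕ<n)
open import Data.Fin.Subset using (Subset; inside; outside; _∩_; ∁; ⊤; ∣_∣; _∈_; _∉_; _⊆_; Nonempty)
open import Data.Fin.Subset.Properties
open import Data.Vec using (_∷_; []; here; there)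
open import Data.Vec.Properties using (lookup∘tabulate; []=⇒lookup; lookup⇒[]=)
open import Data.Product using (_,_; proj₂)
open import Data.Sum using (inj₁; inj₂)
open import Data.Empty using (⊥-elim)
open import Function using (_∘_; Equivalence)
open import Relation.Nullary using (yes; no)
open import Relation.Binary.PropositionalEquality
  using (refl; sym; trans; cong; cong₂; subst; _≢_; ≢-sym; module ≡-Reasoning)

p⊆q⇒p∩q≡p : ∀ {n} {p q : Subset n} → p ⊆ q → p ∩ q ≡ p
p⊆q⇒p∩q≡p {p = p} {q} p⊆q = ⊆-antisym (p∩q⊆p p q) (λ x∈p → x∈p∩q⁺ (x∈p , p⊆q x∈p))

nonempty⇒∣p∣>0 : ∀ {n} {p : Subset n} → Nonempty p → 0 < ∣ p ∣
nonempty⇒∣p∣>0 (_ , x∈p) = ≤-<-trans z≤n (x∈p⇒∣p-x∣<∣p∣ x∈p)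

toℕ<m⇒∣p∣≤m : ∀ {n} m (p : Subset n) → (∀ {x} → x ∈ p → toℕ x < m) → ∣ p ∣ ≤ m
toℕ<m⇒∣p∣≤m m       []            _       = z≤n
toℕ<m⇒∣p∣≤m m       (outside ∷ p) bounded = toℕ<m⇒∣p∣≤m m p (<⇒≤ ∘ bounded ∘ there)
toℕ<m⇒∣p∣≤m zero    (inside  ∷ p) bounded with () ← bounded here
toℕ<m⇒∣p∣≤m (suc m) (inside  ∷ p) bounded = s≤s (toℕ<m⇒∣p∣≤m m p (≤-pred ∘ bounded ∘ there))

∈interval⁻ : ∀ {n a b} {x : Fin n} → x ∈ interval n a b → a ≤ toℕ x + 1 × toℕ x + 1 ≤ b
∈interval⁻ {a = a} {b = b} {x = x} x∈I
  with T-a , T-b ← Equivalence.to T-∧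
                      (Equivalence.from T-≡ (trans (sym (lookup∘tabulate _ x)) ([]=⇒lookup x∈I)))
  = ≤ᵇ⇒≤ a _ T-a , ≤ᵇ⇒≤ _ b T-b

∈interval⁺ : ∀ {n a b} {x : Fin n} → a ≤ toℕ x + 1 → toℕ x + 1 ≤ b → x ∈ interval n a b
∈interval⁺ {x = x} a≤ ≤b =
  lookup⇒[]= x _ (trans (lookup∘tabulate _ x) (Equivalence.to T-≡ (Equivalence.from T-∧ (≤⇒≤ᵇ a≤ , ≤⇒≤ᵇ ≤b))))

∣upto∣≤ : ∀ n m → ∣ upto n m ∣ ≤ m
∣upto∣≤ n m = toℕ<m⇒∣p∣≤m m (upto n m)
  (λ {x} x∈upto → subst (_≤ m) (+-comm (toℕ x) 1) (proj₂ (∈interval⁻ x∈upto)))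

m∸1<n⇒m≤n : ∀ {m n} → m ∸ 1 < n → m ≤ n
m∸1<n⇒m≤n {zero}  _ = z≤n
m∸1<n⇒m≤n {suc m} m<n = m<n

∉upto⇒∈interval : ∀ {n} m {x : Fin n} → x ∉ upto n (m ∸ 1) → x ∈ interval n m n
∉upto⇒∈interval {n} m {x} x∉upto =
  ∈interval⁺ {a = m} (m∸1<n⇒m≤n (≰⇒> x+1≰m∸1)) (subst (_≤ n) (+-comm 1 (toℕ x)) (toℕ<n x))
  where
  x+1≰m∸1 : ¬ toℕ x + 1 ≤ m ∸ 1
  x+1≰m∸1 x+1≤m∸1 = x∉upto (∈interval⁺ (m≤n+m 1 (toℕ x)) x+1≤m∸1)

Additive : ∀ {n} → (Subset n → ℕ) → Set
Additive w = ∀ p X → w X ≡ w (p ∩ X) + w (∁ p ∩ X)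

∣∣-additive : ∀ {n} → Additive (∣_∣ {n})
∣∣-additive []            []            = refl
∣∣-additive (inside  ∷ p) (outside ∷ X) = ∣∣-additive p X
∣∣-additive (outside ∷ p) (outside ∷ X) = ∣∣-additive p X
∣∣-additive (inside  ∷ p) (inside  ∷ X) = cong suc (∣∣-additive p X)
∣∣-additive (outside ∷ p) (inside  ∷ X) = trans (cong suc (∣∣-additive p X)) (sym (+-suc _ _))

∣∩∣-additive : ∀ {n} (U : Subset n) → Additive (λ X → ∣ X ∩ U ∣)
∣∩∣-additive U p X = begin
  ∣ X ∩ U ∣                                   ≡⟨ ∣∣-additive p (X ∩ U) ⟩
  ∣ p ∩ (X ∩ U) ∣ + ∣ ∁ p ∩ (X ∩ U) ∣         ≡⟨ cong₂ (λ A B → ∣ A ∣ + ∣ B ∣) (∩-assoc p X U) (∩-assoc (∁ p) X U) ⟨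
  ∣ (p ∩ X) ∩ U ∣ + ∣ (∁ p ∩ X) ∩ U ∣         ∎
  where open ≡-Reasoning

weight : ∀ {n} → ℕ → Subset n → Subset n → ℕ
weight a U P = a * ∣ P ∣ + ∣ P ∩ U ∣

weight-additive : ∀ {n} a (U : Subset n) → Additive (weight a U)
weight-additive a U p X = begin
  a * ∣ X ∣ + ∣ X ∩ U ∣
    ≡⟨ cong₂ _+_ (cong (a *_) (∣∣-additive p X)) (∣∩∣-additive U p X) ⟩
  a * (x₁ + x₂) + (u₁ + u₂)
    ≡⟨ solve 5 (λ a x₁ x₂ u₁ u₂ → a :* (x₁ :+ x₂) :+ (u₁ :+ u₂) := (a :* x₁ :+ u₁) :+ (a :* x₂ :+ u₂))
             refl a x₁ x₂ u₁ u₂ ⟩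
  (a * x₁ + u₁) + (a * x₂ + u₂) ∎
  where
  open ≡-Reasoning
  open +-*-Solver
  x₁ x₂ u₁ u₂ : ℕ
  x₁ = ∣ p ∩ X ∣
  x₂ = ∣ ∁ p ∩ X ∣
  u₁ = ∣ (p ∩ X) ∩ U ∣
  u₂ = ∣ (∁ p ∩ X) ∩ U ∣

disjoint-members⇒*≤ : ∀ {n} {w : Subset n → ℕ} → Additive w →
  ∀ k c X (F : Fin k → Subset n) → (∀ i → F i ⊆ X) → (∀ i → c ≤ w (F i)) →
  (∀ i j → i ≢ j → Disjoint (F i) (F j)) → k * c ≤ w X
disjoint-members⇒*≤ additive zero    c X F F⊆X c≤wF disjoint = z≤n
disjoint-members⇒*≤ {n} {w} additive (suc k) c X F F⊆X c≤wF disjoint = begin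
  c + k * c                        ≤⟨ +-mono-≤ c≤wF₀ rest ⟩
  w (F₀ ∩ X) + w (∁ F₀ ∩ X)        ≡⟨ sym (additive F₀ X) ⟩
  w X                              ∎
  where
  open ≤-Reasoning
  F₀ : Subset n
  F₀ = F Fin.zero
  c≤wF₀ : c ≤ w (F₀ ∩ X)
  c≤wF₀ = subst (λ P → c ≤ w P) (sym (p⊆q⇒p∩q≡p (F⊆X Fin.zero))) (c≤wF Fin.zero)
  Fsuc⊆∁F₀∩X : ∀ i → F (Fin.suc i) ⊆ ∁ F₀ ∩ X
  Fsuc⊆∁F₀∩X i x∈F =
    x∈p∩q⁺ (x∉p⇒x∈∁p (λ x∈F₀ → disjoint Fin.zero (Fin.suc i) (λ ()) _ (x∈F₀ , x∈F)) , F⊆X (Fin.suc i) x∈F)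
  rest : k * c ≤ w (∁ F₀ ∩ X)
  rest = disjoint-members⇒*≤ additive k c (∁ F₀ ∩ X) (F ∘ Fin.suc) Fsuc⊆∁F₀∩X (c≤wF ∘ Fin.suc)
    (λ i j i≢j → disjoint (Fin.suc i) (Fin.suc j) (i≢j ∘ Finₚ.suc-injective))

weight-obstruction : ∀ {n} {ℱ : Family n} k a c (U : Subset n) →
  (∀ P → ℱ P → c ≤ weight a U P) → a * n + ∣ U ∣ < k * c → ¬ HasDisjointMembers ℱ k
weight-obstruction {n} k a c U c≤weight bound (F , F∈ℱ , disjoint) =
  <⇒≱ bound (subst (k * c ≤_) weight⊤
    (disjoint-members⇒*≤ (weight-additive a U) k c ⊤ F (λ _ _ → ∈⊤) (λ i → c≤weight (F i) (F∈ℱ i)) disjoint))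
  where
  weight⊤ : weight a U ⊤ ≡ a * n + ∣ U ∣
  weight⊤ = cong₂ _+_ (cong (a *_) (∣⊤∣≡n n)) (cong ∣_∣ (∩-identityˡ U))

upto-weight-obstruction : ∀ {n} {ℱ : Family n} k a c m → 1 ≤ m →
  (∀ P → ℱ P → c ≤ weight a (upto n (m ∸ 1)) P) → a * n + m ≡ k * c → ¬ HasDisjointMembers ℱ k
upto-weight-obstruction {n} k a c m 1≤m c≤weight a*n+m≡k*c =
  weight-obstruction k a c (upto n (m ∸ 1)) c≤weight (begin-strict
    a * n + ∣ upto n (m ∸ 1) ∣  ≤⟨ +-monoʳ-≤ (a * n) (∣upto∣≤ n (m ∸ 1)) ⟩
    a * n + (m ∸ 1)            <⟨ +-monoʳ-< (a * n) (∸-monoʳ-< z<s 1≤m) ⟩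
    a * n + m                  ≡⟨ a*n+m≡k*c ⟩
    k * c                      ∎)
  where open ≤-Reasoning

𝒫-weight : ∀ n s ℓ P → 𝒫 n s ℓ P → 3 ≤ weight 1 (upto n (ℓ ∸ 1)) P
𝒫-weight _ _ _ P P∈𝒫 rewrite *-identityˡ ∣ P ∣ = P∈𝒫

𝒫′-weight : ∀ n s ℓ P → 𝒫′ n s ℓ P → 6 ≤ weight 2 (upto n (2 * ℓ ∸ 1)) P
𝒫′-weight _ _ _ _ (inj₁ ∣P∣≥3) = ≤-trans (*-monoʳ-≤ 2 ∣P∣≥3) (m≤m+n _ _)
𝒫′-weight _ _ _ _ (inj₂ (∣P∣≡2 , P⊆V)) rewrite p⊆q⇒p∩q≡p P⊆V | ∣P∣≡2 = ≤-refl

𝒬-weight : ∀ n s ℓ P → 𝒬 n s ℓ P → 4 ≤ weight 1 (upto n (s + ℓ ∸ 1)) P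
𝒬-weight _ _ _ _ (inj₂ (∣P∣≡2 , P⊆Y) , _) rewrite p⊆q⇒p∩q≡p P⊆Y | ∣P∣≡2 = ≤-refl
𝒬-weight n s ℓ P (inj₁ ∣P∣≥3 , ¬tail) rewrite *-identityˡ ∣ P ∣
  with ∣ P ∣ ≟ 3 | nonempty? (P ∩ upto n (s + ℓ ∸ 1))
... | no ∣P∣≢3  | _        = ≤-trans (≤∧≢⇒< ∣P∣≥3 (≢-sym ∣P∣≢3)) (m≤m+n _ _)
... | yes ∣P∣≡3 | yes meets = +-mono-≤ (≤-reflexive (sym ∣P∣≡3)) (nonempty⇒∣p∣>0 meets)
... | yes ∣P∣≡3 | no misses =
  ⊥-elim (¬tail (∣P∣≡3 , λ x∈P →
    ∉upto⇒∈interval (s + ℓ) (λ x∈Y → misses (_ , x∈p∩q⁺ (x∈P , x∈Y)))))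

corollary6 : (n s ℓ c : ℕ) → 1 ≤ c → c ≤ s ∸ 1 → 1 ≤ ℓ → ℓ ≤ s ∸ 1 →
    n ≡ 2 * s + c → n ≡ 3 * s ∸ ℓ →
    ¬ HasDisjointMembers (𝒫 n s ℓ) s × ¬ HasDisjointMembers (𝒫′ n s ℓ) s
      × ¬ HasDisjointMembers (𝒬 n s ℓ) s × ¬ HasDisjointMembers (𝒲 n s ℓ) s
-- The hypotheses on c are redundant, since c = s ∸ ℓ.
corollary6 n s ℓ _ _ _ 1≤ℓ ℓ≤s∸1 _ n≡3s∸ℓ =
    upto-weight-obstruction s 1 3 ℓ       1≤ℓ (𝒫-weight n s ℓ)  𝒫-count
  , upto-weight-obstruction s 2 6 (2 * ℓ) 1≤2ℓ (𝒫′-weight n s ℓ) 𝒫′-count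
  , upto-weight-obstruction s 1 4 (s + ℓ) 1≤s+ℓ (𝒬-weight n s ℓ) 𝒬-count
  , upto-weight-obstruction s 0 2 (2 * s) 1≤2s (λ _ P∈𝒲 → P∈𝒲)  (*-comm 2 s)
  where
  open +-*-Solver
  ℓ≤s : ℓ ≤ s
  ℓ≤s = ≤-trans ℓ≤s∸1 (m∸n≤m s 1)
  1≤2ℓ : 1 ≤ 2 * ℓ
  1≤2ℓ = ≤-trans 1≤ℓ (m≤m+n ℓ _)
  1≤s+ℓ : 1 ≤ s + ℓ
  1≤s+ℓ = ≤-trans 1≤ℓ (m≤n+m ℓ s)
  1≤2s : 1 ≤ 2 * s
  1≤2s = ≤-trans 1≤ℓ (≤-trans ℓ≤s (m≤m+n s _))
  n+ℓ≡3s : n + ℓ ≡ 3 * s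
  n+ℓ≡3s = trans (cong (_+ ℓ) n≡3s∸ℓ) (m∸n+n≡m (≤-trans ℓ≤s (m≤n*m s 3)))
  eliminate-n+ℓ : ∀ a b {lhs} → lhs ≡ a * (n + ℓ) + b * s → lhs ≡ s * (a * 3 + b)
  eliminate-n+ℓ a b lhs≡ = trans lhs≡ (trans (cong (λ t → a * t + b * s) n+ℓ≡3s)
    (solve 3 (λ a b s → a :* (con 3 :* s) :+ b :* s := s :* (a :* con 3 :+ b)) refl a b s))
  𝒫-count : 1 * n + ℓ ≡ s * 3
  𝒫-count = eliminate-n+ℓ 1 0 (solve 3 (λ n ℓ s → con 1 :* n :+ ℓ := con 1 :* (n :+ ℓ) :+ con 0 :* s) refl n ℓ s)
  𝒫′-count : 2 * n + 2 * ℓ ≡ s * 6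
  𝒫′-count = eliminate-n+ℓ 2 0 (solve 3 (λ n ℓ s → con 2 :* n :+ con 2 :* ℓ := con 2 :* (n :+ ℓ) :+ con 0 :* s) refl n ℓ s)
  𝒬-count : 1 * n + (s + ℓ) ≡ s * 4
  𝒬-count = eliminate-n+ℓ 1 1 (solve 3 (λ n ℓ s → con 1 :* n :+ (s :+ ℓ) := con 1 :* (n :+ ℓ) :+ con 1 :* s) refl n ℓ s)
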